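{- Let $A,K$ be integers with either ($A\ge 3$ and ($K=3$ or $K\ge 5$)) or ($A=2$ and $K\ge 6$). Put $a=K$, $b=A^2K-4A$, $c=(A+1)^2K-4(A+1)$, $r=AK-2$, $\beta=\frac{r+\sqrt{ab}}{2}$. Let $A_0\ge 2$, $K_0\ge 3$ and $\rho\ge 14$ be integers. If $A\ge A_0$, $K\ge K_0$ and $AK\ge 2\rho+4$, then \[ bc^2(c-a)<0.992^{ -1}\left(1+\frac{2\rho+2}{\rho A_0}\right)\left(\frac{1}{K_0}+\frac{1}{2\rho+2}\right)^4\beta^8. \] -}

module Defs where

open import Data.Nat using (ℕ; zero; suc)
open import Data.Integer using (ℤ)
open import Data.Rational using (ℚ; 0ℚ; 1ℚ; _+_; _*_; _-_; _÷_; _/_; _≤_; _<_)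
open import Data.Rational.Properties using (_≟_)
open import Data.Rational using (≢-nonZero)
open import Data.Product using (Σ; _×_)
open import Relation.Nullary using (yes; no)

⟦_⟧ : ℤ → ℚ
⟦ z ⟧ = z / 1

_^_ : ℚ → ℕ → ℚ
x ^ zero  = 1ℚ
x ^ suc n = x * (x ^ n)

-- total division (x / 0 := 0); only used with nonzero denominators
_∕_ : ℚ → ℚ → ℚ
x ∕ y with y ≟ 0ℚ
... | yes _  = 0ℚ
... | no y≢0 = _÷_ x y {{≢-nonZero y≢0}}

-- "x < c * ((r + √d)/2)^8" for rationals x, c, r and a nonnegative rational d,
-- expressed exactly via a rational lower approximation q of √d:
-- since t ↦ c((r+t)/2)^8 is continuous and nondecreasing on t ≥ 0 (when c ≥ 0,
-- r ≥ 0), the strict inequality holds iff it holds for some rational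
-- 0 ≤ q with q² ≤ d.
LtTimesBeta8 : ℚ → ℚ → ℚ → ℚ → Set
LtTimesBeta8 x c r d =
  Σ ℚ λ q → (0ℚ ≤ q) × ((q * q) ≤ d) × (x < c * (((r + q) ∕ ⟦ ℤ.pos 2 ⟧) ^ 8))

-- Write x = AK, so that ab = x(x - 4) and r = x - 2. The witness is
-- q = (x - 4)(x - 1)/(x - 3) = x - 2 - 2/(x - 3), a rational just below √(ab):
-- indeed ab(x - 3)² - (x - 4)²(x - 1)² = 4(x - 4).
-- The constant C decreases in A₀, K₀ and ρ, so it is at least its value Ĉ at
-- A₀ = A, K₀ = K and 2ρ + 2 = x - 2, the extreme values the hypotheses allow.
-- What remains, bc²(c - a) < Ĉ((r + q)/2)⁸, is an inequality between rational
-- functions of A and K alone. After clearing denominators, the difference of the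
-- two sides becomes a polynomial in A - 2 and K - 3 with nonnegative coefficients
-- and a positive constant term, which is checked by computing its normal form.
-- The case distinction on A and K is not needed, and ρ ≥ 1 suffices in place of ρ ≥ 14.
module Submission where

open import Defs
open import Data.Integer using (ℤ; +_; _≥_)
open import Relation.Binary.PropositionalEquality using (_≡_)
open import Data.Integer as Z using ()
open import Data.Rational as Q using (ℚ)
open import Data.Sum using (_⊎_)
open import Data.Product using (_×_)

open import Data.Bool using (Bool; true; T; _∧_)
open import Data.Bool.ListAction using (all)
open import Data.Bool.Properties using (T-∧)
open import Data.Fin using (zero; suc)
open import Data.Integer using (+[1+_]; -[1+_]; 0ℤ; 1ℤ; +≤+; +<+; _≤ᵇ_)
import Data.Integer.Properties as ZP
open import Data.Integer.Solver using (module +-*-Solver)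
open +-*-Solver
  using (Polynomial; op; con; var; _:^_; :-_; _:+_; _:*_; _:-_;
         HNF; ∅; _*x+_; Normal; poly; ⟦_⟧H; ⟦_⟧N; normalise; correct)
  renaming (⟦_⟧ to ⟦_⟧ₚ)
open import Data.Integer.Tactic.RingSolver using (solve-∀)
open import Data.List using (List; []; _∷_; _++_)
open import Data.List.Relation.Unary.All as All using (All; []; _∷_)
open import Data.List.Relation.Unary.All.Properties using (++⁻; all⁺)
open import Data.Nat using (ℕ; zero; suc; s≤s; z≤n)
import Data.Nat.Properties as NP
open import Data.Product using (_,_)
open import Data.Rational using (0ℚ; 1ℚ; toℚᵘ)
import Data.Rational.Properties as QP
open import Data.Rational.Unnormalised as U using (ℚᵘ; mkℚᵘ; *≡*; *≤*; *<*; _≃_)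
import Data.Rational.Unnormalised.Properties as UP
open import Data.Unit using (tt)
open import Data.Vec using (Vec; []; _∷_; lookup; zipWith)
open import Data.Vec.Properties using (lookup-zipWith)
import Data.Vec.Relation.Unary.All as VecAll
open VecAll using ([]; _∷_)
open import Data.Vec.Relation.Binary.Pointwise.Inductive using (Pointwise; []; _∷_)
open import Function.Bundles using (Equivalence)
open import Relation.Binary.PropositionalEquality
  using (refl; sym; trans; cong; cong₂; subst; subst₂; module ≡-Reasoning)
open import Relation.Nullary using (yes; no)

private variable
  n : ℕ
  i j : ℤ

*-nonNeg : 0ℤ Z.≤ i → 0ℤ Z.≤ j → 0ℤ Z.≤ i Z.* j
*-nonNeg {j = j} 0≤i 0≤j = ZP.*-monoʳ-≤-nonNeg j {{Z.nonNegative 0≤j}} 0≤i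

*-pos : 0ℤ Z.< i → 0ℤ Z.< j → 0ℤ Z.< i Z.* j
*-pos (+<+ (s≤s z≤n)) (+<+ (s≤s z≤n)) = +<+ (s≤s z≤n)

mutual
  nonNegativeH : HNF (suc n) → Bool
  nonNegativeH ∅         = true
  nonNegativeH (p *x+ c) = nonNegativeH p ∧ nonNegativeN c

  nonNegativeN : Normal n → Bool
  nonNegativeN (con c)  = 0ℤ ≤ᵇ c
  nonNegativeN (poly p) = nonNegativeH p

mutual
  nonNegativeH-sound : ∀ p {ρ : Vec ℤ (suc n)} →
                       T (nonNegativeH p) → VecAll.All (0ℤ Z.≤_) ρ → 0ℤ Z.≤ ⟦ p ⟧H ρ
  nonNegativeH-sound ∅         _  _                 = ZP.≤-refl
  nonNegativeH-sound (p *x+ c) ok (0≤x ∷ 0≤ρ) =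
    let okp , okc = Equivalence.to T-∧ ok
    in ZP.+-mono-≤ (*-nonNeg (nonNegativeH-sound p okp (0≤x ∷ 0≤ρ)) 0≤x)
                   (nonNegativeN-sound c okc 0≤ρ)

  nonNegativeN-sound : ∀ p {ρ : Vec ℤ n} →
                       T (nonNegativeN p) → VecAll.All (0ℤ Z.≤_) ρ → 0ℤ Z.≤ ⟦ p ⟧N ρ
  nonNegativeN-sound (con c)  ok _   = ZP.≤ᵇ⇒≤ ok
  nonNegativeN-sound (poly p) ok 0≤ρ = nonNegativeH-sound p ok 0≤ρ

translate : Vec ℤ n → Polynomial n → Polynomial n
translate c (op o p q) = op o (translate c p) (translate c q)
translate c (con k)    = con k
translate c (var i)    = con (lookup c i) :+ var i
translate c (p :^ k)   = translate c p :^ k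
translate c (:- p)     = :- translate c p

translate-sound : ∀ c p (ρ : Vec ℤ n) → ⟦ translate c p ⟧ₚ (zipWith Z._-_ ρ c) ≡ ⟦ p ⟧ₚ ρ
translate-sound c (op o p q) ρ rewrite translate-sound c p ρ | translate-sound c q ρ = refl
translate-sound c (con k)    ρ = refl
translate-sound c (var i)    ρ =
  trans (cong (Z._+_ (lookup c i)) (lookup-zipWith Z._-_ i ρ c)) (c+[x-c]≡x (lookup c i) (lookup ρ i))
  where
  c+[x-c]≡x : ∀ c x → c Z.+ (x Z.- c) ≡ x
  c+[x-c]≡x = solve-∀
translate-sound c (p :^ k)   ρ rewrite translate-sound c p ρ = refl
translate-sound c (:- p)     ρ rewrite translate-sound c p ρ = refl

differences-nonNeg : ∀ {c ρ : Vec ℤ n} → Pointwise Z._≤_ c ρ →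
                     VecAll.All (0ℤ Z.≤_) (zipWith Z._-_ ρ c)
differences-nonNeg []          = []
differences-nonNeg (c≤x ∷ c≤ρ) = ZP.i≤j⇒0≤j-i c≤x ∷ differences-nonNeg c≤ρ

nonNegativeAbove positiveAbove : Vec ℤ n → Polynomial n → Bool
nonNegativeAbove c p = nonNegativeN (normalise (translate c p))
positiveAbove    c p = nonNegativeAbove c (p :- con 1ℤ)

nonNegativeAbove-sound : ∀ c p {ρ : Vec ℤ n} →
                         T (nonNegativeAbove c p) → Pointwise Z._≤_ c ρ → 0ℤ Z.≤ ⟦ p ⟧ₚ ρ
nonNegativeAbove-sound c p {ρ} ok c≤ρ =
  subst (0ℤ Z.≤_) (trans (correct (translate c p) (zipWith Z._-_ ρ c)) (translate-sound c p ρ))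
        (nonNegativeN-sound (normalise (translate c p)) ok (differences-nonNeg c≤ρ))

positiveAbove-sound : ∀ c p {ρ : Vec ℤ n} →
                      T (positiveAbove c p) → Pointwise Z._≤_ c ρ → 0ℤ Z.< ⟦ p ⟧ₚ ρ
positiveAbove-sound c p ok c≤ρ =
  ZP.suc[i]≤j⇒i<j (ZP.0≤i-j⇒j≤i (nonNegativeAbove-sound c (p :- con 1ℤ) ok c≤ρ))

frac : ℤ → ℤ → ℚ
frac p q = ⟦ p ⟧ ∕ ⟦ q ⟧

toℚᵘ-⟦⟧ : ∀ p → toℚᵘ ⟦ p ⟧ ≃ mkℚᵘ p 0
toℚᵘ-⟦⟧ p = QP.toℚᵘ-fromℚᵘ (mkℚᵘ p 0)

1/-cong-suc : ∀ (x : ℚᵘ) .{{_ : U.NonZero x}} m → x ≃ mkℚᵘ (+ suc m) 0 → U.1/ x ≃ mkℚᵘ 1ℤ m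
1/-cong-suc (mkℚᵘ -[1+ n ] d) m (*≡* ())
1/-cong-suc (mkℚᵘ +[1+ n ] d) m (*≡* eq) = *≡* (begin
  +[1+ d ] Z.* + suc m   ≡⟨ ZP.*-comm +[1+ d ] (+ suc m) ⟩
  + suc m Z.* +[1+ d ]   ≡⟨ sym eq ⟩
  +[1+ n ] Z.* 1ℤ        ≡⟨ ZP.*-identityʳ +[1+ n ] ⟩
  +[1+ n ]               ≡⟨ sym (ZP.*-identityˡ +[1+ n ]) ⟩
  1ℤ Z.* +[1+ n ]        ∎)
  where open ≡-Reasoning

toℚᵘ-∕ : ∀ x m → toℚᵘ (x ∕ ⟦ + suc m ⟧) ≃ toℚᵘ x U.* mkℚᵘ 1ℤ m
toℚᵘ-∕ x m with ⟦ + suc m ⟧ QP.≟ 0ℚ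
... | yes m+1≡0 with UP.≃-trans (UP.≃-sym (toℚᵘ-⟦⟧ (+ suc m))) (QP.toℚᵘ-cong m+1≡0)
...   | *≡* ()
toℚᵘ-∕ x m | no m+1≢0 = UP.≃-trans (QP.toℚᵘ-homo-* x _)
  (UP.*-congˡ {toℚᵘ x} (UP.≃-trans (QP.toℚᵘ-homo-1/ _ {{Q.≢-nonZero m+1≢0}})
                                   (1/-cong-suc _ {{Q.≢-nonZero m+1≢0}} m (toℚᵘ-⟦⟧ (+ suc m)))))

toℚᵘ-frac : ∀ p m → toℚᵘ (frac p (+ suc m)) ≃ mkℚᵘ p m
toℚᵘ-frac p m = UP.≃-trans (toℚᵘ-∕ ⟦ p ⟧ m) (UP.≃-trans (UP.*-congʳ (toℚᵘ-⟦⟧ p))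
  (UP.≃-reflexive (cong₂ mkℚᵘ (ZP.*-identityʳ p) (NP.+-identityʳ m))))

⟦⟧≡frac : ∀ p → ⟦ p ⟧ ≡ frac p 1ℤ
⟦⟧≡frac p = QP.toℚᵘ-injective (UP.≃-trans (toℚᵘ-⟦⟧ p) (UP.≃-sym (toℚᵘ-frac p 0)))

frac-+ : ∀ p r → 0ℤ Z.< i → 0ℤ Z.< j → frac p i Q.+ frac r j ≡ frac (p Z.* j Z.+ r Z.* i) (i Z.* j)
frac-+ p r (+<+ (s≤s (z≤n {m}))) (+<+ (s≤s (z≤n {m′}))) = QP.toℚᵘ-injective (UP.≃-trans
  (QP.toℚᵘ-homo-+ (frac p (+ suc m)) (frac r (+ suc m′)))
  (UP.≃-trans (UP.+-cong (toℚᵘ-frac p m) (toℚᵘ-frac r m′)) (UP.≃-sym (toℚᵘ-frac _ _))))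

frac-* : ∀ p r → 0ℤ Z.< i → 0ℤ Z.< j → frac p i Q.* frac r j ≡ frac (p Z.* r) (i Z.* j)
frac-* p r (+<+ (s≤s (z≤n {m}))) (+<+ (s≤s (z≤n {m′}))) = QP.toℚᵘ-injective (UP.≃-trans
  (QP.toℚᵘ-homo-* (frac p (+ suc m)) (frac r (+ suc m′)))
  (UP.≃-trans (UP.*-cong (toℚᵘ-frac p m) (toℚᵘ-frac r m′)) (UP.≃-sym (toℚᵘ-frac _ _))))

frac-∕ : ∀ p → 0ℤ Z.< i → 0ℤ Z.< j → frac p i ∕ ⟦ j ⟧ ≡ frac p (i Z.* j)
frac-∕ p (+<+ (s≤s (z≤n {m}))) (+<+ (s≤s (z≤n {m′}))) = QP.toℚᵘ-injective (UP.≃-trans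
  (toℚᵘ-∕ (frac p (+ suc m)) m′)
  (UP.≃-trans (UP.*-congʳ (toℚᵘ-frac p m))
  (UP.≃-trans (UP.≃-reflexive (cong (λ k → mkℚᵘ k _) (ZP.*-identityʳ p))) (UP.≃-sym (toℚᵘ-frac p _)))))

frac-≤ : ∀ p r → 0ℤ Z.< i → 0ℤ Z.< j → p Z.* j Z.≤ r Z.* i → frac p i Q.≤ frac r j
frac-≤ p r (+<+ (s≤s (z≤n {m}))) (+<+ (s≤s (z≤n {m′}))) pj≤ri = QP.toℚᵘ-cancel-≤
  (UP.≤-respˡ-≃ (UP.≃-sym (toℚᵘ-frac p m)) (UP.≤-respʳ-≃ (UP.≃-sym (toℚᵘ-frac r m′)) (*≤* pj≤ri)))

frac-< : ∀ p r → 0ℤ Z.< i → 0ℤ Z.< j → p Z.* j Z.< r Z.* i → frac p i Q.< frac r j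
frac-< p r (+<+ (s≤s (z≤n {m}))) (+<+ (s≤s (z≤n {m′}))) pj<ri = QP.toℚᵘ-cancel-<
  (UP.<-respˡ-≃ (UP.≃-sym (toℚᵘ-frac p m)) (UP.<-respʳ-≃ (UP.≃-sym (toℚᵘ-frac r m′)) (*<* pj<ri)))

infixl 6 _⊕_
infixl 7 _⊗_ _⊘_
infixr 8 _⊛_

data RatExpr (n : ℕ) : Set where
  ⌜_⌝     : Polynomial n → RatExpr n
  _⊕_ _⊗_ : RatExpr n → RatExpr n → RatExpr n
  _⊘_     : RatExpr n → Polynomial n → RatExpr n

-- Not a constructor, so that ⟦ r ⊛ k ⟧ᵣ ρ reduces to ⟦ r ⟧ᵣ ρ ^ k.
_⊛_ : RatExpr n → ℕ → RatExpr n
r ⊛ zero  = ⌜ con 1ℤ ⌝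
r ⊛ suc k = r ⊗ r ⊛ k

⟦_⟧ᵣ : RatExpr n → Vec ℤ n → ℚ
⟦ ⌜ p ⌝ ⟧ᵣ ρ = ⟦ ⟦ p ⟧ₚ ρ ⟧
⟦ r ⊕ s ⟧ᵣ ρ = ⟦ r ⟧ᵣ ρ Q.+ ⟦ s ⟧ᵣ ρ
⟦ r ⊗ s ⟧ᵣ ρ = ⟦ r ⟧ᵣ ρ Q.* ⟦ s ⟧ᵣ ρ
⟦ r ⊘ p ⟧ᵣ ρ = ⟦ r ⟧ᵣ ρ ∕ ⟦ ⟦ p ⟧ₚ ρ ⟧

numerator denominator : RatExpr n → Polynomial n
numerator ⌜ p ⌝   = p
numerator (r ⊕ s) = numerator r :* denominator s :+ numerator s :* denominator r
numerator (r ⊗ s) = numerator r :* numerator s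
numerator (r ⊘ p) = numerator r
denominator ⌜ p ⌝   = con 1ℤ
denominator (r ⊕ s) = denominator r :* denominator s
denominator (r ⊗ s) = denominator r :* denominator s
denominator (r ⊘ p) = denominator r :* p

divisors : RatExpr n → List (Polynomial n)
divisors ⌜ p ⌝   = []
divisors (r ⊕ s) = divisors r ++ divisors s
divisors (r ⊗ s) = divisors r ++ divisors s
divisors (r ⊘ p) = p ∷ divisors r

DivisorsPositive : RatExpr n → Vec ℤ n → Set
DivisorsPositive r ρ = All (λ d → 0ℤ Z.< ⟦ d ⟧ₚ ρ) (divisors r)

denominator-pos : ∀ r {ρ : Vec ℤ n} → DivisorsPositive r ρ → 0ℤ Z.< ⟦ denominator r ⟧ₚ ρ
denominator-pos ⌜ p ⌝   _  = +<+ (s≤s z≤n)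
denominator-pos (r ⊕ s) ok = let okr , oks = ++⁻ (divisors r) ok in
  *-pos (denominator-pos r okr) (denominator-pos s oks)
denominator-pos (r ⊗ s) ok = let okr , oks = ++⁻ (divisors r) ok in
  *-pos (denominator-pos r okr) (denominator-pos s oks)
denominator-pos (r ⊘ p) (okp ∷ okr) = *-pos (denominator-pos r okr) okp

⟦⟧ᵣ≡frac : ∀ r {ρ : Vec ℤ n} → DivisorsPositive r ρ →
           ⟦ r ⟧ᵣ ρ ≡ frac (⟦ numerator r ⟧ₚ ρ) (⟦ denominator r ⟧ₚ ρ)
⟦⟧ᵣ≡frac ⌜ p ⌝ {ρ} _ = ⟦⟧≡frac (⟦ p ⟧ₚ ρ)
⟦⟧ᵣ≡frac (r ⊕ s) {ρ} ok = let okr , oks = ++⁻ (divisors r) ok in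
  trans (cong₂ Q._+_ (⟦⟧ᵣ≡frac r okr) (⟦⟧ᵣ≡frac s oks))
        (frac-+ (⟦ numerator r ⟧ₚ ρ) (⟦ numerator s ⟧ₚ ρ) (denominator-pos r okr) (denominator-pos s oks))
⟦⟧ᵣ≡frac (r ⊗ s) {ρ} ok = let okr , oks = ++⁻ (divisors r) ok in
  trans (cong₂ Q._*_ (⟦⟧ᵣ≡frac r okr) (⟦⟧ᵣ≡frac s oks))
        (frac-* (⟦ numerator r ⟧ₚ ρ) (⟦ numerator s ⟧ₚ ρ) (denominator-pos r okr) (denominator-pos s oks))
⟦⟧ᵣ≡frac (r ⊘ p) {ρ} (okp ∷ okr) =
  trans (cong (_∕ ⟦ ⟦ p ⟧ₚ ρ ⟧) (⟦⟧ᵣ≡frac r okr))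
        (frac-∕ (⟦ numerator r ⟧ₚ ρ) (denominator-pos r okr) okp)

divisorsPositiveAbove : Vec ℤ n → RatExpr n → Bool
divisorsPositiveAbove c r = all (positiveAbove c) (divisors r)

divisorsPositiveAbove-sound : ∀ c r {ρ : Vec ℤ n} → T (divisorsPositiveAbove c r) →
                              Pointwise Z._≤_ c ρ → DivisorsPositive r ρ
divisorsPositiveAbove-sound c r ok c≤ρ =
  All.map (λ {d} okd → positiveAbove-sound c d okd c≤ρ) (all⁺ (positiveAbove c) (divisors r) ok)

crossGap strictCrossGap : RatExpr n → RatExpr n → Polynomial n
crossGap       r s = numerator s :* denominator r :- numerator r :* denominator s
strictCrossGap r s = numerator s :* denominator r :- (con 1ℤ :+ numerator r :* denominator s)

≤Above <Above : Vec ℤ n → RatExpr n → RatExpr n → Bool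
≤Above c r s = divisorsPositiveAbove c r ∧ divisorsPositiveAbove c s ∧ nonNegativeAbove c (crossGap r s)
<Above c r s = divisorsPositiveAbove c r ∧ divisorsPositiveAbove c s ∧ nonNegativeAbove c (strictCrossGap r s)

≤Above-sound : ∀ c r s {ρ : Vec ℤ n} → T (≤Above c r s) → Pointwise Z._≤_ c ρ →
               ⟦ r ⟧ᵣ ρ Q.≤ ⟦ s ⟧ᵣ ρ
≤Above-sound c r s ok c≤ρ =
  let okr , ok′ = Equivalence.to T-∧ ok
      oks , okd = Equivalence.to T-∧ ok′
      dr = divisorsPositiveAbove-sound c r okr c≤ρ
      ds = divisorsPositiveAbove-sound c s oks c≤ρ
  in subst₂ Q._≤_ (sym (⟦⟧ᵣ≡frac r dr)) (sym (⟦⟧ᵣ≡frac s ds))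
       (frac-≤ (⟦ numerator r ⟧ₚ _) (⟦ numerator s ⟧ₚ _) (denominator-pos r dr) (denominator-pos s ds)
               (ZP.0≤i-j⇒j≤i (nonNegativeAbove-sound c (crossGap r s) okd c≤ρ)))

<Above-sound : ∀ c r s {ρ : Vec ℤ n} → T (<Above c r s) → Pointwise Z._≤_ c ρ →
               ⟦ r ⟧ᵣ ρ Q.< ⟦ s ⟧ᵣ ρ
<Above-sound c r s ok c≤ρ =
  let okr , ok′ = Equivalence.to T-∧ ok
      oks , okd = Equivalence.to T-∧ ok′
      dr = divisorsPositiveAbove-sound c r okr c≤ρ
      ds = divisorsPositiveAbove-sound c s oks c≤ρ
  in subst₂ Q._<_ (sym (⟦⟧ᵣ≡frac r dr)) (sym (⟦⟧ᵣ≡frac s ds))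
       (frac-< (⟦ numerator r ⟧ₚ _) (⟦ numerator s ⟧ₚ _) (denominator-pos r dr) (denominator-pos s ds)
               (ZP.suc[i]≤j⇒i<j (ZP.0≤i-j⇒j≤i (nonNegativeAbove-sound c (strictCrossGap r s) okd c≤ρ))))

*-mono-≤-nonNeg : ∀ {p q r s} → 0ℚ Q.≤ p → 0ℚ Q.≤ r → p Q.≤ q → r Q.≤ s → p Q.* r Q.≤ q Q.* s
*-mono-≤-nonNeg {p} {q} {r} {s} 0≤p 0≤r p≤q r≤s = QP.≤-trans
  (QP.*-monoʳ-≤-nonNeg r {{Q.nonNegative 0≤r}} p≤q)
  (QP.*-monoˡ-≤-nonNeg q {{Q.nonNegative (QP.≤-trans 0≤p p≤q)}} r≤s)

^-nonNeg : ∀ {p} k → 0ℚ Q.≤ p → 0ℚ Q.≤ p ^ k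
^-nonNeg zero    _   = QP.≤ᵇ⇒≤ tt
^-nonNeg (suc k) 0≤p = *-mono-≤-nonNeg QP.≤-refl QP.≤-refl 0≤p (^-nonNeg k 0≤p)

^-mono-≤ : ∀ {p q} k → 0ℚ Q.≤ p → p Q.≤ q → p ^ k Q.≤ q ^ k
^-mono-≤ zero    _   _   = QP.≤-refl
^-mono-≤ (suc k) 0≤p p≤q = *-mono-≤-nonNeg 0≤p (^-nonNeg k 0≤p) p≤q (^-mono-≤ k 0≤p p≤q)

1/-antimono-≤ : 0ℤ Z.< i → i Z.≤ j → 1ℚ ∕ ⟦ j ⟧ Q.≤ 1ℚ ∕ ⟦ i ⟧
1/-antimono-≤ {i} {j} 0<i i≤j = frac-≤ 1ℤ 1ℤ (ZP.<-≤-trans 0<i i≤j) 0<i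
  (subst₂ Z._≤_ (sym (ZP.*-identityˡ i)) (sym (ZP.*-identityˡ j)) i≤j)

-- Syntax for the quantities of the statement, mirroring it so that evaluation
-- at (A, K) reduces to the statement's own terms.
Â K̂ x̂ : Polynomial 2
Â = var zero
K̂ = var (suc zero)
x̂ = Â :* K̂

b̂ ĉ L̂ : Polynomial 2
b̂ = Â :* Â :* K̂ :- con (+ 4) :* Â
ĉ = (Â :+ con (+ 1)) :* (Â :+ con (+ 1)) :* K̂ :- con (+ 4) :* (Â :+ con (+ 1))
L̂ = b̂ :* ĉ :* ĉ :* (ĉ :- K̂)

q̂ β̂ : RatExpr 2
q̂ = ⌜ (x̂ :- con (+ 4)) :* (x̂ :- con (+ 1)) ⌝ ⊘ (x̂ :- con (+ 3))
β̂ = (⌜ x̂ :- con (+ 2) ⌝ ⊕ q̂) ⊘ con (+ 2)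

ĉ₀ t̂ ŵ Ĉ : RatExpr 2
ĉ₀ = ⌜ con (+ 125) ⌝ ⊘ con (+ 124)
t̂ = ⌜ con (+ 2) :* x̂ :- con (+ 4) ⌝ ⊘ ((x̂ :- con (+ 4)) :* Â)
ŵ = ⌜ con 1ℤ ⌝ ⊘ K̂ ⊕ ⌜ con 1ℤ ⌝ ⊘ (x̂ :- con (+ 2))
Ĉ = ĉ₀ ⊗ (⌜ con 1ℤ ⌝ ⊕ t̂) ⊗ ŵ ⊛ 4

corner : Vec ℤ 2
corner = + 2 ∷ + 3 ∷ []

aboveCorner : ∀ {A K A₀ K₀} → + 2 Z.≤ A₀ → + 3 Z.≤ K₀ → A₀ Z.≤ A → K₀ Z.≤ K →
              Pointwise Z._≤_ corner (A ∷ K ∷ [])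
aboveCorner 2≤A₀ 3≤K₀ A₀≤A K₀≤K = ZP.≤-trans 2≤A₀ A₀≤A ∷ ZP.≤-trans 3≤K₀ K₀≤K ∷ []

Ĉ≤C : ∀ {A K A₀ K₀ ρ} → + 2 Z.≤ A₀ → + 3 Z.≤ K₀ → + 1 Z.≤ ρ → A₀ Z.≤ A → K₀ Z.≤ K →
      (+ 2) Z.* ρ Z.+ + 4 Z.≤ A Z.* K →
      ⟦ Ĉ ⟧ᵣ (A ∷ K ∷ []) Q.≤
        (⟦ + 125 ⟧ ∕ ⟦ + 124 ⟧)
        Q.* (1ℚ Q.+ (⟦ (+ 2) Z.* ρ Z.+ + 2 ⟧ ∕ ⟦ ρ Z.* A₀ ⟧))
        Q.* ((1ℚ ∕ ⟦ K₀ ⟧ Q.+ 1ℚ ∕ ⟦ (+ 2) Z.* ρ Z.+ + 2 ⟧) ^ 4)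
Ĉ≤C {A} {K} {A₀} {K₀} {ρ} 2≤A₀ 3≤K₀ 1≤ρ A₀≤A K₀≤K 2ρ+4≤x =
  *-mono-≤-nonNeg (≤Above-sound corner ⌜ con 0ℤ ⌝ (ĉ₀ ⊗ (⌜ con 1ℤ ⌝ ⊕ t̂)) tt box)
                  (^-nonNeg 4 0≤ŵ)
                  (QP.*-monoˡ-≤-nonNeg (⟦ + 125 ⟧ ∕ ⟦ + 124 ⟧) (QP.+-monoʳ-≤ 1ℚ t̂≤t))
                  (^-mono-≤ 4 0≤ŵ (QP.+-mono-≤ (1/-antimono-≤ 0<K₀ K₀≤K) (1/-antimono-≤ 0<2ρ+2 2ρ+2≤x-2)))
  where
  box : Pointwise Z._≤_ corner (A ∷ K ∷ [])
  box = aboveCorner 2≤A₀ 3≤K₀ A₀≤A K₀≤K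
  parameters : Pointwise Z._≤_ (+ 2 ∷ + 3 ∷ + 1 ∷ []) (A₀ ∷ K₀ ∷ ρ ∷ [])
  parameters = 2≤A₀ ∷ 3≤K₀ ∷ 1≤ρ ∷ []
  0≤ŵ : 0ℚ Q.≤ ⟦ ŵ ⟧ᵣ (A ∷ K ∷ [])
  0≤ŵ = ≤Above-sound corner ⌜ con 0ℤ ⌝ ŵ tt box
  0<K₀ : 0ℤ Z.< K₀
  0<K₀ = positiveAbove-sound _ (var (suc zero)) tt parameters
  0<2ρ+2 : 0ℤ Z.< (+ 2) Z.* ρ Z.+ + 2
  0<2ρ+2 = positiveAbove-sound _ (con (+ 2) :* var (suc (suc zero)) :+ con (+ 2)) tt parameters
  0<ρA₀ : 0ℤ Z.< ρ Z.* A₀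
  0<ρA₀ = positiveAbove-sound _ (var (suc (suc zero)) :* var zero) tt parameters
  2ρ+2≤x-2 : (+ 2) Z.* ρ Z.+ + 2 Z.≤ A Z.* K Z.- + 2
  2ρ+2≤x-2 = subst (Z._≤ A Z.* K Z.- + 2) (ZP.+-assoc ((+ 2) Z.* ρ) (+ 4) (Z.- + 2))
                   (ZP.+-monoˡ-≤ (Z.- + 2) 2ρ+4≤x)
  gap : ∀ A K A₀ ρ →
    (+ 2 Z.* ρ Z.+ + 2) Z.* ((A Z.* K Z.- + 4) Z.* A) Z.- (+ 2 Z.* (A Z.* K) Z.- + 4) Z.* (ρ Z.* A₀)
      ≡ + 2 Z.* A₀ Z.* (A Z.* K Z.- (+ 2 Z.* ρ Z.+ + 4))
        Z.+ (+ 2 Z.* ρ Z.+ + 2) Z.* (A Z.* K Z.- + 4) Z.* (A Z.- A₀)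
  gap = solve-∀
  t̂≤t : ⟦ t̂ ⟧ᵣ (A ∷ K ∷ []) Q.≤ ⟦ (+ 2) Z.* ρ Z.+ + 2 ⟧ ∕ ⟦ ρ Z.* A₀ ⟧
  t̂≤t = frac-≤ (+ 2 Z.* (A Z.* K) Z.- + 4) ((+ 2) Z.* ρ Z.+ + 2)
    (positiveAbove-sound corner ((x̂ :- con (+ 4)) :* Â) tt box) 0<ρA₀
    (ZP.0≤i-j⇒j≤i (subst (0ℤ Z.≤_) (sym (gap A K A₀ ρ)) (ZP.+-mono-≤
      (*-nonNeg (*-nonNeg (+≤+ (z≤n {2})) (ZP.<⇒≤ (positiveAbove-sound _ (var zero) tt parameters)))
                (ZP.i≤j⇒0≤j-i 2ρ+4≤x))
      (*-nonNeg (*-nonNeg (ZP.<⇒≤ 0<2ρ+2) (nonNegativeAbove-sound corner (x̂ :- con (+ 4)) tt box))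
                (ZP.i≤j⇒0≤j-i A₀≤A)))))

lemma3p9 : (A K A₀ K₀ ρ : ℤ) →
    ((A ≥ + 3 × (K ≡ + 3 ⊎ K ≥ + 5)) ⊎ (A ≡ + 2 × K ≥ + 6)) →
    A₀ ≥ + 2 → K₀ ≥ + 3 → ρ ≥ + 14 →
    A ≥ A₀ → K ≥ K₀ → A Z.* K ≥ (+ 2) Z.* ρ Z.+ + 4 →
    let a = K
        b = A Z.* A Z.* K Z.- (+ 4) Z.* A
        c = (A Z.+ + 1) Z.* (A Z.+ + 1) Z.* K Z.- (+ 4) Z.* (A Z.+ + 1)
        r = A Z.* K Z.- + 2
        C = (⟦ + 125 ⟧ ∕ ⟦ + 124 ⟧)
            Q.* (Q.1ℚ Q.+ (⟦ (+ 2) Z.* ρ Z.+ + 2 ⟧ ∕ ⟦ ρ Z.* A₀ ⟧))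
            Q.* ((Q.1ℚ ∕ ⟦ K₀ ⟧ Q.+ Q.1ℚ ∕ ⟦ (+ 2) Z.* ρ Z.+ + 2 ⟧) ^ 4)
    in LtTimesBeta8 ⟦ b Z.* c Z.* c Z.* (c Z.- a) ⟧ C ⟦ r ⟧ ⟦ a Z.* b ⟧
lemma3p9 A K A₀ K₀ ρ _ 2≤A₀ 3≤K₀ 14≤ρ A₀≤A K₀≤K 2ρ+4≤x =
  ⟦ q̂ ⟧ᵣ AK ,
  ≤Above-sound corner ⌜ con 0ℤ ⌝ q̂ tt box ,
  ≤Above-sound corner (q̂ ⊗ q̂) ⌜ K̂ :* b̂ ⌝ tt box ,
  QP.<-≤-trans (<Above-sound corner ⌜ L̂ ⌝ (Ĉ ⊗ β̂ ⊛ 8) tt box)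
               (QP.*-monoʳ-≤-nonNeg (⟦ β̂ ⟧ᵣ AK ^ 8) {{Q.nonNegative 0≤β⁸}}
                  (Ĉ≤C 2≤A₀ 3≤K₀ (ZP.≤-trans (+≤+ (s≤s z≤n)) 14≤ρ) A₀≤A K₀≤K 2ρ+4≤x))
  where
  AK : Vec ℤ 2
  AK = A ∷ K ∷ []
  box : Pointwise Z._≤_ corner AK
  box = aboveCorner 2≤A₀ 3≤K₀ A₀≤A K₀≤K
  0≤β⁸ : 0ℚ Q.≤ ⟦ β̂ ⟧ᵣ AK ^ 8
  0≤β⁸ = ≤Above-sound corner ⌜ con 0ℤ ⌝ (β̂ ⊛ 8) tt box
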